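{- Let $G$ be a finite simple graph with $V(G)=[n]$, $\gamma$ a choice function, $F$ a spanning forest of $G$, and $\pi$ the ordering of $[n]$ determined by $F$ and $\gamma$ in Step 1 of Algorithm B. An edge $e\in E(G)$ is $F$-redundant if and only if its endpoints can be labeled $v,w$ so that one of the following holds: (1) both $v$ and $w$ are roots of $F$; (2) $v$ is a root and $w$ is a non-root of $F$, and $\pi^{ -1}(w)<\pi^{ -1}(v)$; (3) $v$ and $w$ are non-roots and $\pi^{ -1}(v^p)<\pi^{ -1}(w)<\pi^{ -1}(v)$. Moreover, in case (3), $v$ and $w$ lie in the same tree of $F$.
   Context: $V(G)=[n]$ is ordered as integers. A subforest of $G$ is a subgraph of $G$ (not necessarily containing all vertices) without cycles; $\mathrm{Leaf}(F)$ is its set of degree-$1$ vertices. A choice function $\gamma$ assigns to each pair $(F,W)$, with $F$ a subforest of $G$ and $W$ a nonempty subset of $\mathrm{Leaf}(F)$ or a set consisting of one isolated vertex of $F$, an element $\gamma(F,W)\in W$. A spanning forest of $G$ is an acyclic subgraph with vertex set $V(G)$; the root of each tree component is its least vertex, and for a non-root $v$, $v^p$ is the neighbor of $v$ on the path in $F$ from $v$ to its root. Algorithm B (defining $\Psi_{\gamma,G}$). Given a spanning forest $F$ with roots $r_1=1<\dots<r_k$: Step 1: define an ordering $v_1,\dots,v_n$ of $[n]$ ($\pi(i)=v_i$) by $v_1=1$ and, given $V_i=\{v_1,\dots,v_i\}$: if no edge of $F$ joins $V_i$ to its complement, $v_{i+1}$ is the smallest vertex not in $V_i$; otherwise let $W$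 be the set of vertices outside $V_i$ joined by an $F$-edge to $V_i$, $F'$ the restriction of $F$ to $V_i\cup W$, and $v_{i+1}=\gamma(F',W)$. Step 2: $f(r_j)=\infty$ for roots and $f(v)=\#\{u:\{v,u\}\in E(G),\ \pi^{ -1}(u)<\pi^{ -1}(v^p)\}$ for non-roots; $\Psi_{\gamma,G}(F):=f$. (The same definition applies to any graph containing $F$ with vertex set $[n]$.) An edge $e\in E(G)\setminus E(F)$ is called $F$-redundant if $\Psi_{\gamma,G-e}(F)=\Psi_{\gamma,G}(F)$, where $G-e$ is $G$ with the edge $e$ deleted. Edges of $F$ are not $F$-redundant. -}

module Defs where

open import Data.Nat.Base using (ℕ; zero; suc; _≤_; _<_; _<ᵇ_)
open import Data.Fin.Base using (Fin; zero; suc; toℕ)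
open import Data.Fin.Properties using (_≟_)
open import Data.Bool.Base using (Bool; true; false; _∧_; _∨_; not; if_then_else_)
open import Data.List.Base using (List; []; _∷_; _++_; [_]; length)
open import Data.List.Relation.Unary.Unique.Propositional using (Unique)
open import Data.List.Relation.Unary.Linked using (Linked)
open import Data.Maybe.Base using (Maybe; just; nothing; maybe)
open import Data.Product.Base using (Σ; _×_; _,_)
open import Data.Sum.Base using (_⊎_)
open import Relation.Binary.PropositionalEquality using (_≡_; _≢_)
open import Relation.Binary.Construct.Closure.ReflexiveTransitive using (Star)
open import Relation.Nullary.Decidable using (⌊_⌋)
open import Relation.Nullary.Negation using (¬_)
open import Function.Bundles using (_⇔_)

-- Vertices: [n] is modelled by Fin n (vertex i+1 of the paper is the
-- element of Fin n with toℕ = i; the order of [n] is the order of toℕ).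

VSet : ℕ → Set
VSet n = Fin n → Bool

ESet : ℕ → Set
ESet n = Fin n → Fin n → Bool

record Graph (n : ℕ) : Set where
  field
    adj    : ESet n
    sym    : ∀ u v → adj u v ≡ adj v u
    irrefl : ∀ v → adj v v ≡ false
open Graph public

countF : ∀ {n} → (Fin n → Bool) → ℕ
countF {zero}  p = 0
countF {suc n} p = (if p zero then 1 else 0) Data.Nat.Base.+ countF (λ i → p (suc i))

anyF : ∀ {n} → (Fin n → Bool) → Bool
anyF {zero}  p = false
anyF {suc n} p = p zero ∨ anyF (λ i → p (suc i))

firstF : ∀ {n} → (Fin n → Bool) → Maybe (Fin n)
firstF {zero}  p = nothing
firstF {suc n} p = if p zero then just zero
                   else Data.Maybe.Base.map suc (firstF (λ i → p (suc i)))

inList : ∀ {n} → List (Fin n) → Fin n → Bool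
inList []       u = false
inList (x ∷ xs) u = ⌊ x ≟ u ⌋ ∨ inList xs u

indexOf : ∀ {n} → List (Fin n) → Fin n → ℕ
indexOf []       u = 0
indexOf (x ∷ xs) u = if ⌊ x ≟ u ⌋ then 0 else suc (indexOf xs u)

EdgeRel : ∀ {n} → ESet n → Fin n → Fin n → Set
EdgeRel E a b = E a b ≡ true

Cycle : ∀ {n} → ESet n → Set
Cycle {n} E = Σ (Fin n) λ x → Σ (List (Fin n)) λ ys →
  (2 ≤ length ys) × Unique (x ∷ ys) × Linked (EdgeRel E) (x ∷ ys ++ [ x ])

Acyclic : ∀ {n} → ESet n → Set
Acyclic E = ¬ Cycle E

record IsSubforest {n} (G : Graph n) (S : VSet n) (E : ESet n) : Set where
  field
    e-sym     : ∀ a b → E a b ≡ E b a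
    e-inG     : ∀ a b → E a b ≡ true → adj G a b ≡ true
    e-inS     : ∀ a b → E a b ≡ true → S a ≡ true
    acyclic   : Acyclic E

IsSpanningForest : ∀ {n} → Graph n → ESet n → Set
IsSpanningForest G E = IsSubforest G (λ _ → true) E

degree : ∀ {n} → ESet n → Fin n → ℕ
degree E v = countF (E v)

IsLeaf : ∀ {n} → ESet n → Fin n → Set
IsLeaf E v = degree E v ≡ 1

ValidW : ∀ {n} → VSet n → ESet n → VSet n → Set
ValidW {n} S E W =
  ((Σ (Fin n) λ u → W u ≡ true) × (∀ u → W u ≡ true → IsLeaf E u))
  ⊎ (Σ (Fin n) λ u → (∀ x → (W x ≡ true) ⇔ (x ≡ u)) × S u ≡ true × degree E u ≡ 0)

-- A choice function: takes a subforest (vertex set, edge set) and W.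
ChoiceFn : ℕ → Set
ChoiceFn n = VSet n → ESet n → VSet n → Fin n

-- γ is a choice function for G: on every subforest F of G and admissible W
-- it returns an element of W, and it depends only on the sets (F , W)
-- (not on how they are represented as functions).
record IsChoiceFunction {n} (G : Graph n) (γ : ChoiceFn n) : Set where
  field
    choice : ∀ S E W → IsSubforest G S E → ValidW S E W → W (γ S E W) ≡ true
    extensional : ∀ S S′ E E′ W W′ → (∀ a → S a ≡ S′ a) → (∀ a b → E a b ≡ E′ a b)
                  → (∀ a → W a ≡ W′ a) → γ S E W ≡ γ S′ E′ W′

-- Given Vᵢ (as the list v₁ … vᵢ), the next vertex v_{i+1} (if any).
-- For Vᵢ = ∅ this gives the smallest vertex, i.e. v₁ = 1.
nextVertex : ∀ {n} → ChoiceFn n → ESet n → List (Fin n) → Maybe (Fin n)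
nextVertex γ F Vi =
  if anyF W
  then just (γ S′ F′ W)
  else firstF (λ u → not (inList Vi u))
  where
    W : VSet _
    W u = not (inList Vi u) ∧ anyF (λ x → inList Vi x ∧ F x u)
    S′ : VSet _
    S′ u = inList Vi u ∨ W u
    F′ : ESet _
    F′ a b = F a b ∧ S′ a ∧ S′ b

orderUpTo : ∀ {n} → ChoiceFn n → ESet n → ℕ → List (Fin n)
orderUpTo γ F zero    = []
orderUpTo γ F (suc k) =
  maybe (λ v → Vk ++ [ v ]) Vk (nextVertex γ F Vk)
  where Vk = orderUpTo γ F k

order : ∀ {n} → ChoiceFn n → ESet n → List (Fin n)
order {n} γ F = orderUpTo γ F n

-- π⁻¹ (0-based position in the ordering)
πinv : ∀ {n} → ChoiceFn n → ESet n → Fin n → ℕ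
πinv γ F u = indexOf (order γ F) u

Connected : ∀ {n} → ESet n → Fin n → Fin n → Set
Connected F = Star (EdgeRel F)

IsRoot : ∀ {n} → ESet n → Fin n → Set
IsRoot F v = ∀ u → Connected F v u → toℕ v ≤ toℕ u

AvoidRel : ∀ {n} → ESet n → Fin n → Fin n → Fin n → Set
AvoidRel F v a b = F a b ≡ true × a ≢ v × b ≢ v

-- p = vᵖ: v is a non-root, p is an F-neighbour of v, and p lies on the path
-- from v to its root r (i.e. p reaches r in F without passing through v)
IsParent : ∀ {n} → ESet n → Fin n → Fin n → Set
IsParent {n} F v p =
  ¬ IsRoot F v × F v p ≡ true ×
  Σ (Fin n) λ r → IsRoot F r × Star (AvoidRel F v) p r

-- Algorithm B, Step 2 (relative to an arbitrary adjacency A ⊇ F);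
-- ∞ is represented by nothing.

PsiAt : ∀ {n} → ChoiceFn n → ESet n → ESet n → Fin n → Maybe ℕ → Set
PsiAt {n} γ A F v x =
  (IsRoot F v × x ≡ nothing)
  ⊎ (Σ (Fin n) λ p → IsParent F v p ×
       x ≡ just (countF (λ u → A v u ∧ (πinv γ F u <ᵇ πinv γ F p))))

IsPsi : ∀ {n} → ChoiceFn n → ESet n → ESet n → (Fin n → Maybe ℕ) → Set
IsPsi γ A F f = ∀ v → PsiAt γ A F v (f v)

deleteEdge : ∀ {n} → ESet n → Fin n → Fin n → ESet n
deleteEdge A u w a b =
  A a b ∧ not ((⌊ a ≟ u ⌋ ∧ ⌊ b ≟ w ⌋) ∨ (⌊ a ≟ w ⌋ ∧ ⌊ b ≟ u ⌋))

Redundant : ∀ {n} → Graph n → ChoiceFn n → ESet n → Fin n → Fin n → Set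
Redundant {n} G γ F u w =
  F u w ≡ false ×
  (∀ (f g : Fin n → Maybe ℕ) → IsPsi γ (adj G) F f →
     IsPsi γ (deleteEdge (adj G) u w) F g → ∀ v → f v ≡ g v)

Case1 : ∀ {n} → ESet n → Fin n → Fin n → Set
Case1 F v w = IsRoot F v × IsRoot F w

Case2 : ∀ {n} → ChoiceFn n → ESet n → Fin n → Fin n → Set
Case2 γ F v w = IsRoot F v × ¬ IsRoot F w × πinv γ F w < πinv γ F v

Case3 : ∀ {n} → ChoiceFn n → ESet n → Fin n → Fin n → Set
Case3 {n} γ F v w = ¬ IsRoot F v × ¬ IsRoot F w ×
  Σ (Fin n) λ p → IsParent F v p × πinv γ F p < πinv γ F w × πinv γ F w < πinv γ F v

Cases : ∀ {n} → ChoiceFn n → ESet n → Fin n → Fin n → Set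
Cases γ F v w = Case1 F v w ⊎ Case2 γ F v w ⊎ Case3 γ F v w

-- Step 1 of Algorithm B keeps the visited set V_k equal to a union of whole trees of F plus a
-- subtree, containing the root, of one further tree: the next vertex is either the least
-- unvisited vertex, which is then a root because V_k is closed under F, or a frontier leaf,
-- whose unique visited neighbour is its parent (two visited neighbours would close a cycle).
-- Consequently parents precede children, the neighbours of a root that precede it are only
-- adjacent to vertices preceding it, and all F-edges leaving V_k start in a single tree.
-- Deleting e = {x, y} can change Ψ only at x and y, and changes it at x exactly when x has a
-- parent p with π⁻¹(y) < π⁻¹(p). So e is redundant iff e ∉ F and neither endpoint precedes the
-- parent of the other, and the facts above turn this condition into the three cases.
module Submission where

open import Defs hiding (sym)
open import Data.Nat.Base using (ℕ; zero; suc; _+_; _∸_; _≤_; _<_; _<ᵇ_; z≤n; s≤s)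
open import Data.Nat.Properties
  using (+-suc; +-identityʳ; suc-injective; ≤-trans; ≤-antisym; n≤1+n; 1+n≰n; 1+n≢n; m≤m+n; m∸n+n≡m;
         n<1+n; m<n⇒m<1+n; <⇒≤; <-irrefl; <-trans; <-≤-trans; <-cmp; ≤∧≢⇒<; _≤?_; ≰⇒>; <⇒≱;
         <ᵇ⇒<; <⇒<ᵇ)
open import Data.Fin.Base using (Fin; zero; suc; toℕ)
open import Data.Fin.Properties using (_≟_; toℕ-injective)
open import Data.Bool.Base using (Bool; true; false; _∧_; _∨_; not; if_then_else_; T)
open import Data.Bool.Properties
  using (∧-comm; ∧-identityʳ; ∧-zeroʳ; ∧-conicalˡ; ∧-conicalʳ; ∨-comm; ∨-identityʳ; ∨-zeroʳ;
         ∨-conicalˡ; ∨-conicalʳ; if-cong; not-injective; ¬-not)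
open import Data.List.Base using (List; []; _∷_; _++_; [_]; length)
open import Data.List.Properties using (++-assoc; ++-identityʳ)
open import Data.List.Relation.Unary.All using (All; []; _∷_)
open import Data.List.Relation.Unary.All.Properties.Core using (¬Any⇒All¬)
open import Data.List.Relation.Unary.AllPairs using ([]; _∷_)
open import Data.List.Relation.Unary.Any using (Any; here; there; any?)
open import Data.List.Relation.Unary.Linked as Linked using (Linked; [-]; _∷_)
open import Data.List.Relation.Unary.Unique.Propositional using (Unique)
open import Data.Maybe.Base using (Maybe; just; nothing; maybe)
open import Data.Maybe.Properties using (just-injective)
open import Data.Product.Base using (Σ; _×_; _,_; proj₁; proj₂)
open import Data.Sum.Base using (_⊎_; inj₁; inj₂)
open import Data.Empty using (⊥; ⊥-elim)
open import Function.Bundles using (_⇔_; mk⇔)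
open import Function.Construct.Composition using (_⇔-∘_)
open import Function.Construct.Symmetry using (⇔-sym)
open import Relation.Binary.PropositionalEquality hiding ([_])
open import Relation.Binary.Definitions using (tri<; tri≈; tri>)
open import Relation.Binary.Construct.Closure.ReflexiveTransitive as Star using (Star; ε; _◅_; _◅◅_)
open import Relation.Nullary using (¬_; Dec; yes; no)
open import Relation.Nullary.Decidable using (⌊_⌋)

private
  variable
    n : ℕ

≡true⇒≢false : ∀ {b} → b ≡ true → b ≢ false
≡true⇒≢false refl ()

∨-≡-true : ∀ a b → a ∨ b ≡ true → a ≡ true ⊎ b ≡ true
∨-≡-true true  b e = inj₁ refl
∨-≡-true false b e = inj₂ e

adj⇒≢ : (G : Graph n) {x y : Fin n} → adj G x y ≡ true → x ≢ y
adj⇒≢ G {x} xy refl = ≡true⇒≢false xy (Graph.irrefl G x)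

countF-cong : {p q : Fin n → Bool} → (∀ u → p u ≡ q u) → countF p ≡ countF q
countF-cong {zero}  e = refl
countF-cong {suc n} e rewrite e zero = cong (_ +_) (countF-cong (λ i → e (suc i)))

countF-insert : (p q : Fin n → Bool) (v : Fin n) → (∀ u → u ≢ v → p u ≡ q u) →
                p v ≡ false → q v ≡ true → countF q ≡ suc (countF p)
countF-insert p q zero e pv qv rewrite pv | qv =
  cong suc (countF-cong (λ i → sym (e (suc i) λ ())))
countF-insert p q (suc v) e pv qv rewrite e zero (λ ()) =
  trans (cong (head +_) (countF-insert (λ i → p (suc i)) (λ i → q (suc i)) v
                        (λ u u≢v → e (suc u) (λ { refl → u≢v refl })) pv qv))
        (+-suc head _)
  where head = if q zero then 1 else 0

countF-≤ : (p : Fin n → Bool) → countF p ≤ n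
countF-≤ {zero}  p = z≤n
countF-≤ {suc n} p with p zero
... | true  = s≤s (countF-≤ (λ i → p (suc i)))
... | false = ≤-trans (countF-≤ (λ i → p (suc i))) (n≤1+n n)

countF-≥⇒all : (p : Fin n → Bool) → n ≤ countF p → ∀ u → p u ≡ true
countF-≥⇒all {suc n} p le u with p zero in eq
countF-≥⇒all {suc n} p (s≤s le) zero    | true  = eq
countF-≥⇒all {suc n} p (s≤s le) (suc u) | true  = countF-≥⇒all (λ i → p (suc i)) le u
... | false = ⊥-elim (1+n≰n (≤-trans le (countF-≤ (λ i → p (suc i)))))

countF-false : ∀ n → countF {n} (λ _ → false) ≡ 0
countF-false zero    = refl
countF-false (suc n) = countF-false n

countF-singleton : (p : Fin n → Bool) (v : Fin n) → p v ≡ true → (∀ u → p u ≡ true → u ≡ v) →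
                   countF p ≡ 1
countF-singleton {n} p v pv unique =
  trans (countF-insert (λ _ → false) p v (λ u u≢v → sym (off u u≢v)) refl pv)
        (cong suc (countF-false n))
  where
  off : ∀ u → u ≢ v → p u ≡ false
  off u u≢v with p u in pu
  ... | true  = ⊥-elim (u≢v (unique u pu))
  ... | false = refl

anyF⇒∃ : (p : Fin n → Bool) → anyF p ≡ true → Σ (Fin n) λ u → p u ≡ true
anyF⇒∃ {suc n} p e with p zero in p0
... | true  = zero , p0
... | false with anyF⇒∃ (λ i → p (suc i)) e
...   | u , pu = suc u , pu

anyF-intro : (p : Fin n → Bool) (u : Fin n) → p u ≡ true → anyF p ≡ true
anyF-intro p zero    pu rewrite pu = refl
anyF-intro p (suc u) pu rewrite anyF-intro (λ i → p (suc i)) u pu = ∨-zeroʳ (p zero)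

anyF-false : (p : Fin n → Bool) → anyF p ≡ false → ∀ u → p u ≡ false
anyF-false {suc n} p e zero    = ∨-conicalˡ (p zero) _ e
anyF-false {suc n} p e (suc u) = anyF-false (λ i → p (suc i)) (∨-conicalʳ (p zero) _ e) u

firstF-nothing : (p : Fin n → Bool) → firstF p ≡ nothing → ∀ u → p u ≡ false
firstF-nothing {suc n} p e u with p zero in p0 | firstF (λ i → p (suc i)) in rest
firstF-nothing {suc n} p e zero    | false | _       = p0
firstF-nothing {suc n} p e (suc u) | false | nothing = firstF-nothing (λ i → p (suc i)) rest u

firstF-just : (p : Fin n → Bool) (v : Fin n) → firstF p ≡ just v →
              p v ≡ true × (∀ u → p u ≡ true → toℕ v ≤ toℕ u)
firstF-just {suc n} p v e with p zero in p0 | firstF (λ i → p (suc i)) in rest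
firstF-just {suc n} p .zero refl | true | _ = p0 , λ _ _ → z≤n
firstF-just {suc n} p .(suc w) refl | false | just w with firstF-just (λ i → p (suc i)) w rest
... | pw , least = pw , λ { zero pu → ⊥-elim (≡true⇒≢false pu p0)
                          ; (suc u) pu → s≤s (least u pu) }

≟-refl : (v : Fin n) → ⌊ v ≟ v ⌋ ≡ true
≟-refl v with v ≟ v
... | yes _   = refl
... | no  v≢v = ⊥-elim (v≢v refl)

≟-≢ : {u v : Fin n} → u ≢ v → ⌊ u ≟ v ⌋ ≡ false
≟-≢ {u = u} {v} u≢v with u ≟ v
... | yes u≡v = ⊥-elim (u≢v u≡v)
... | no  _   = refl

inList-++ : (xs ys : List (Fin n)) (u : Fin n) → inList (xs ++ ys) u ≡ inList xs u ∨ inList ys u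
inList-++ []       ys u = refl
inList-++ (x ∷ xs) ys u with ⌊ x ≟ u ⌋
... | true  = refl
... | false = inList-++ xs ys u

inList-singleton : (v u : Fin n) → inList [ v ] u ≡ ⌊ v ≟ u ⌋
inList-singleton v u = ∨-identityʳ ⌊ v ≟ u ⌋

indexOf-< : (xs : List (Fin n)) (u : Fin n) → inList xs u ≡ true → indexOf xs u < length xs
indexOf-< (x ∷ xs) u e with x ≟ u
... | yes _ = s≤s z≤n
... | no  _ = s≤s (indexOf-< xs u e)

indexOf-++ˡ : (xs ys : List (Fin n)) (u : Fin n) → inList xs u ≡ true →
              indexOf (xs ++ ys) u ≡ indexOf xs u
indexOf-++ˡ (x ∷ xs) ys u e with x ≟ u
... | yes _ = refl
... | no  _ = cong suc (indexOf-++ˡ xs ys u e)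

indexOf-++ʳ : (xs ys : List (Fin n)) (u : Fin n) → inList xs u ≡ false →
              indexOf (xs ++ ys) u ≡ length xs + indexOf ys u
indexOf-++ʳ []       ys u e = refl
indexOf-++ʳ (x ∷ xs) ys u e with x ≟ u
... | no _ = cong suc (indexOf-++ʳ xs ys u e)

indexOf-singleton : (v : Fin n) → indexOf [ v ] v ≡ 0
indexOf-singleton v rewrite ≟-refl v = refl

indexOf-injective : (xs : List (Fin n)) {u v : Fin n} → inList xs u ≡ true → inList xs v ≡ true →
                    indexOf xs u ≡ indexOf xs v → u ≡ v
indexOf-injective (x ∷ xs) {u} {v} eu ev e with x ≟ u | x ≟ v
... | yes refl | yes refl = refl
... | no  _    | no  _    = indexOf-injective xs eu ev (suc-injective e)

<ᵇ-true : ∀ {m k} → m < k → (m <ᵇ k) ≡ true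
<ᵇ-true {m} {k} m<k with m <ᵇ k | <⇒<ᵇ m<k
... | true | _ = refl

<ᵇ-false : ∀ {m k} → k ≤ m → (m <ᵇ k) ≡ false
<ᵇ-false {m} {k} k≤m with m <ᵇ k in e
... | true  = ⊥-elim (<⇒≱ (<ᵇ⇒< m k (subst T (sym e) _)) k≤m)
... | false = refl

module _ (A : ESet n) {x y : Fin n} where

  deleteEdge-comm : ∀ a b → deleteEdge A x y a b ≡ deleteEdge A y x a b
  deleteEdge-comm a b =
    cong (λ c → A a b ∧ not c) (∨-comm (⌊ a ≟ x ⌋ ∧ ⌊ b ≟ y ⌋) (⌊ a ≟ y ⌋ ∧ ⌊ b ≟ x ⌋))

  deleteEdge-≢ : ∀ {a b} → a ≢ x → a ≢ y → deleteEdge A x y a b ≡ A a b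
  deleteEdge-≢ {a} {b} a≢x a≢y rewrite ≟-≢ a≢x | ≟-≢ a≢y = ∧-identityʳ (A a b)

  deleteEdge-from : ∀ {b} → b ≢ y → deleteEdge A x y x b ≡ A x b
  deleteEdge-from {b} b≢y with x ≟ y
  ... | yes refl rewrite ≟-≢ b≢y | ∧-zeroʳ ⌊ y ≟ y ⌋ = ∧-identityʳ (A y b)
  ... | no  x≢y  rewrite ≟-≢ b≢y | ∧-zeroʳ ⌊ x ≟ x ⌋ = ∧-identityʳ (A x b)

  deleteEdge-deleted : deleteEdge A x y x y ≡ false
  deleteEdge-deleted rewrite ≟-refl x | ≟-refl y = ∧-zeroʳ (A x y)

countBelow : (Fin n → ℕ) → ESet n → Fin n → ℕ → ℕ
countBelow ρ A v k = countF (λ u → A v u ∧ (ρ u <ᵇ k))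

module _ (ρ : Fin n → ℕ) (A : ESet n) {x y : Fin n} where

  countBelow-deleteEdge-≢ : ∀ {v} k → v ≢ x → v ≢ y →
                            countBelow ρ (deleteEdge A x y) v k ≡ countBelow ρ A v k
  countBelow-deleteEdge-≢ {v = v} k v≢x v≢y =
    countF-cong λ u → cong (_∧ (ρ u <ᵇ k)) (deleteEdge-≢ A v≢x v≢y)

  countBelow-deleteEdge-comm : ∀ {v} k →
                               countBelow ρ (deleteEdge A x y) v k ≡ countBelow ρ (deleteEdge A y x) v k
  countBelow-deleteEdge-comm {v = v} k = countF-cong λ u → cong (_∧ (ρ u <ᵇ k)) (deleteEdge-comm A v u)

  countBelow-deleteEdge-≤ : ∀ {k} → k ≤ ρ y → countBelow ρ (deleteEdge A x y) x k ≡ countBelow ρ A x k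
  countBelow-deleteEdge-≤ {k} k≤y = countF-cong λ u → same u (u ≟ y)
    where
    same : ∀ u → Dec (u ≡ y) → (deleteEdge A x y x u ∧ (ρ u <ᵇ k)) ≡ (A x u ∧ (ρ u <ᵇ k))
    same u (yes refl) rewrite <ᵇ-false {ρ y} k≤y = trans (∧-zeroʳ _) (sym (∧-zeroʳ _))
    same u (no u≢y)   = cong (_∧ (ρ u <ᵇ k)) (deleteEdge-from A u≢y)

  countBelow-deleteEdge-< : ∀ {k} → A x y ≡ true → ρ y < k →
                            countBelow ρ A x k ≡ suc (countBelow ρ (deleteEdge A x y) x k)
  countBelow-deleteEdge-< {k} xy y<k =
    countF-insert _ _ y (λ u u≢y → cong (_∧ (ρ u <ᵇ k)) (deleteEdge-from A u≢y))
      (cong (_∧ (ρ y <ᵇ k)) (deleteEdge-deleted A))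
      (trans (cong (_∧ (ρ y <ᵇ k)) xy) (<ᵇ-true y<k))

module _ {n : ℕ} {R : Fin n → Fin n → Set} where

  mutual
    vertices : ∀ {a b} → Star R a b → List (Fin n)
    vertices {a} w = a ∷ laterVertices w

    laterVertices : ∀ {a b} → Star R a b → List (Fin n)
    laterVertices ε       = []
    laterVertices (_ ◅ w) = vertices w

  SimpleWalk : Fin n → Fin n → Set
  SimpleWalk a b = Σ (Star R a b) λ w → Unique (vertices w)

  dropUntil : ∀ a {x b} (w : Star R x b) → Unique (vertices w) → Any (a ≡_) (vertices w) →
              SimpleWalk a b
  dropUntil a ε       u               (here refl) = ε , u
  dropUntil a (r ◅ w) u               (here refl) = r ◅ w , u
  dropUntil a (r ◅ w) (_ ∷ u)         (there i)   = dropUntil a w u i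

  loopErase : ∀ {a b} → Star R a b → SimpleWalk a b
  loopErase ε = ε , [] ∷ []
  loopErase {a} (r ◅ w) with loopErase w
  ... | w′ , u′ with any? (a ≟_) (vertices w′)
  ...   | yes a∈w′ = dropUntil a w′ u′ a∈w′
  ...   | no  a∉w′ = r ◅ w′ , ¬Any⇒All¬ (vertices w′) a∉w′ ∷ u′

module _ {n : ℕ} (F : ESet n) (c : Fin n) where

  private
    avoids : ∀ {a b} → a ≢ c → (w : Star (AvoidRel F c) a b) → All (c ≢_) (vertices w)
    avoids a≢c ε                   = (λ c≡a → a≢c (sym c≡a)) ∷ []
    avoids a≢c ((_ , _ , b≢c) ◅ w) = (λ c≡a → a≢c (sym c≡a)) ∷ avoids b≢c w

    closeUp : ∀ {a b} (w : Star (AvoidRel F c) a b) → F b c ≡ true →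
              Linked (EdgeRel F) (vertices w ++ [ c ])
    closeUp ε              bc = bc ∷ [-]
    closeUp ((ab , _) ◅ w) bc = ab ∷ closeUp w bc

  avoidingWalk⇒cycle : ∀ {a b} → F c a ≡ true → F b c ≡ true → a ≢ b →
                       Star (AvoidRel F c) a b → Cycle F
  avoidingWalk⇒cycle ca bc a≢b w with loopErase w
  ... | ε , _ = ⊥-elim (a≢b refl)
  ... | (r@(_ , a≢c , _) ◅ w′) , u =
    c , vertices (r ◅ w′) , s≤s (s≤s z≤n) , avoids a≢c (r ◅ w′) ∷ u , ca ∷ closeUp (r ◅ w′) bc

module Forest {n : ℕ} (G : Graph n) (F : ESet n) (forest : IsSpanningForest G F) where

  open IsSubforest forest

  private
    variable
      a b c r r′ : Fin n

  edge-sym : F a b ≡ true → F b a ≡ true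
  edge-sym {a} {b} ab = trans (e-sym b a) ab

  edge⇒≢ : F a b ≡ true → a ≢ b
  edge⇒≢ {a} aa refl = ≡true⇒≢false (e-inG a a aa) (Graph.irrefl G a)

  connected-sym : Connected F a b → Connected F b a
  connected-sym = Star.reverse edge-sym

  root-unique : IsRoot F r → IsRoot F r′ → Connected F r r′ → r ≡ r′
  root-unique {r} {r′} root root′ c =
    toℕ-injective (≤-antisym (root r′ c) (root′ r (connected-sym c)))

  Within : VSet n → Fin n → Fin n → Set
  Within S a b = F a b ≡ true × S a ≡ true × S b ≡ true

  module _ {S : VSet n} where

    within-sym : Star (Within S) a b → Star (Within S) b a
    within-sym = Star.reverse λ (ab , sa , sb) → edge-sym ab , sb , sa

    within⇒connected : Star (Within S) a b → Connected F a b
    within⇒connected = Star.map proj₁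

    within-mono : ∀ {S′} → (∀ u → S u ≡ true → S′ u ≡ true) →
                  Star (Within S) a b → Star (Within S′) a b
    within-mono S⊆S′ = Star.map λ (ab , sa , sb) → ab , S⊆S′ _ sa , S⊆S′ _ sb

    within⇒avoiding : S c ≡ false → Star (Within S) a b → Star (AvoidRel F c) a b
    within⇒avoiding sc = Star.map λ (ab , sa , sb) →
      ab , (λ { refl → ≡true⇒≢false sa sc }) , (λ { refl → ≡true⇒≢false sb sc })

  avoiding-sym : Star (AvoidRel F c) a b → Star (AvoidRel F c) b a
  avoiding-sym = Star.reverse λ (ab , a≢c , b≢c) → edge-sym ab , b≢c , a≢c

  avoiding⇒connected : Star (AvoidRel F c) a b → Connected F a b
  avoiding⇒connected = Star.map proj₁

module AlgorithmB {n : ℕ} (G : Graph n) (γ : ChoiceFn n) (choice : IsChoiceFunction G γ)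
                  (F : ESet n) (forest : IsSpanningForest G F) where

  open IsSubforest forest using (e-sym; e-inG; acyclic)
  open Forest G F forest

  private
    variable
      a b c d p q u v w x : Fin n
      k m : ℕ

  V : ℕ → List (Fin n)
  V = orderUpTo γ F

  visited : ℕ → VSet n
  visited k = inList (V k)

  -- frontier, reached and reachedForest unfold to W, S′ and F′ of nextVertex.
  frontier : ℕ → VSet n
  frontier k u = not (visited k u) ∧ anyF (λ x → visited k x ∧ F x u)

  reached : ℕ → VSet n
  reached k u = visited k u ∨ frontier k u

  reachedForest : ℕ → ESet n
  reachedForest k a b = F a b ∧ reached k a ∧ reached k b

  Closed : ℕ → Set
  Closed k = ∀ a b → visited k a ≡ true → F a b ≡ true → visited k b ≡ true

  record Appends (k : ℕ) (v : Fin n) : Set where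
    constructor appends
    field
      unvisited : visited k v ≡ false
      extends   : V (suc k) ≡ V k ++ [ v ]

  V-step : ∀ k → Σ (List (Fin n)) λ ys → V (suc k) ≡ V k ++ ys
  V-step k with nextVertex γ F (V k)
  ... | just v  = [ v ] , refl
  ... | nothing = [] , sym (++-identityʳ (V k))

  V-prefix : k ≤ m → Σ (List (Fin n)) λ ys → V m ≡ V k ++ ys
  V-prefix {k} {m} k≤m =
    subst (λ m → Σ (List (Fin n)) λ ys → V m ≡ V k ++ ys) (m∸n+n≡m k≤m) (go (m ∸ k))
    where
    go : ∀ d → Σ (List (Fin n)) λ ys → V (d + k) ≡ V k ++ ys
    go zero = [] , sym (++-identityʳ (V k))
    go (suc d) with go d | V-step (d + k)
    ... | ys , eq | zs , eq′ = ys ++ zs , trans eq′ (trans (cong (_++ zs) eq) (++-assoc (V k) ys zs))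

  visited-suc : visited k u ≡ true → visited (suc k) u ≡ true
  visited-suc {k} {u} vu with V-step k
  ... | ys , eq = begin
    inList (V (suc k)) u        ≡⟨ cong (λ xs → inList xs u) eq ⟩
    inList (V k ++ ys) u        ≡⟨ inList-++ (V k) ys u ⟩
    inList (V k) u ∨ inList ys u ≡⟨ cong (_∨ inList ys u) vu ⟩
    true                        ∎
    where open ≡-Reasoning

  first-visit : visited m v ≡ true → Σ ℕ λ k → k < m × visited k v ≡ false × visited (suc k) v ≡ true
  first-visit {zero}  ()
  first-visit {suc m} {v} vv with visited m v in vm
  ... | false = m , n<1+n m , vm , vv
  ... | true with first-visit vm
  ...   | k , k<m , rest = k , m<n⇒m<1+n k<m , rest

  module Appended {k v} (app : Appends k v) where
    open Appends app

    visited-append : ∀ u → visited (suc k) u ≡ visited k u ∨ ⌊ v ≟ u ⌋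
    visited-append u = begin
      inList (V (suc k)) u            ≡⟨ cong (λ xs → inList xs u) extends ⟩
      inList (V k ++ [ v ]) u         ≡⟨ inList-++ (V k) [ v ] u ⟩
      inList (V k) u ∨ inList [ v ] u ≡⟨ cong (inList (V k) u ∨_) (inList-singleton v u) ⟩
      visited k u ∨ ⌊ v ≟ u ⌋         ∎
      where open ≡-Reasoning

    visited-appended : visited (suc k) v ≡ true
    visited-appended =
      trans (visited-append v) (trans (cong (visited k v ∨_) (≟-refl v)) (∨-zeroʳ (visited k v)))

    visited-append⇒ : visited (suc k) u ≡ true → visited k u ≡ true ⊎ u ≡ v
    visited-append⇒ {u} vu with ∨-≡-true (visited k u) _ (trans (sym (visited-append u)) vu)
    ... | inj₁ old = inj₁ old
    ... | inj₂ new with v ≟ u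
    ...   | yes v≡u = inj₂ (sym v≡u)

    unvisited-append⇒ : visited (suc k) u ≡ false → visited k u ≡ false
    unvisited-append⇒ {u} nu with visited k u in vu
    ... | true  = ⊥-elim (≡true⇒≢false (visited-suc {k = k} vu) nu)
    ... | false = refl

    count-append : countF (visited (suc k)) ≡ suc (countF (visited k))
    count-append = countF-insert (visited k) (visited (suc k)) v unchanged unvisited visited-appended
      where
      unchanged : ∀ u → u ≢ v → visited k u ≡ visited (suc k) u
      unchanged u u≢v = sym (begin
        visited (suc k) u       ≡⟨ visited-append u ⟩
        visited k u ∨ ⌊ v ≟ u ⌋ ≡⟨ cong (visited k u ∨_) (≟-≢ (λ v≡u → u≢v (sym v≡u))) ⟩
        visited k u ∨ false     ≡⟨ ∨-identityʳ (visited k u) ⟩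
        visited k u             ∎)
        where open ≡-Reasoning

  RootedIn : ℕ → Fin n → Set
  RootedIn k u = Σ (Fin n) λ r → IsRoot F r × visited k r ≡ true × Star (Within (visited k)) u r

  record Invariant (k : ℕ) : Set where
    field
      rooted : visited k u ≡ true → RootedIn k u
      exits-connected : visited k a ≡ true → F a b ≡ true → visited k b ≡ false →
                        visited k c ≡ true → F c d ≡ true → visited k d ≡ false → Connected F a c
      progress : (∀ u → visited k u ≡ true) ⊎ k ≤ countF (visited k)

  frontier⇒ : ∀ k → frontier k u ≡ true →
              visited k u ≡ false × Σ (Fin n) λ x → visited k x ≡ true × F x u ≡ true
  frontier⇒ {u} k fu with visited k u
  ... | false with anyF⇒∃ (λ x → visited k x ∧ F x u) fu
  ...   | x , vx∧xu = refl , x , ∧-conicalˡ _ _ vx∧xu , ∧-conicalʳ _ _ vx∧xu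

  module _ {k} (inv : Invariant k) where
    open Invariant inv

    connected⇒within : visited k a ≡ true → visited k b ≡ true → Connected F a b →
                       Star (Within (visited k)) a b
    connected⇒within {a} {b} va vb a~b with rooted va | rooted vb
    ... | r , root , _ , a~r | r′ , root′ , _ , b~r′
      with root-unique root root′
             (connected-sym (within⇒connected a~r) ◅◅ a~b ◅◅ within⇒connected b~r′)
    ... | refl = a~r ◅◅ within-sym b~r′

    -- Two visited neighbours of an unvisited u are joined inside V_k, giving a cycle through u.
    visited-neighbour-unique : visited k u ≡ false → visited k a ≡ true → visited k b ≡ true →
                               F a u ≡ true → F b u ≡ true → a ≡ b
    visited-neighbour-unique {u} {a} {b} nu va vb au bu with a ≟ b
    ... | yes a≡b = a≡b
    ... | no  a≢b = ⊥-elim (acyclic (avoidingWalk⇒cycle F u (edge-sym au) bu a≢b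
                      (within⇒avoiding nu (connected⇒within va vb (au ◅ edge-sym bu ◅ ε)))))

    frontier-independent : frontier k u ≡ true → frontier k b ≡ true → F u b ≡ true → ⊥
    frontier-independent {u} {b} fu fb ub with frontier⇒ k fu | frontier⇒ k fb
    ... | nu , x , vx , xu | nb , x′ , vx′ , x′b =
      acyclic (avoidingWalk⇒cycle F u (edge-sym xu) (edge-sym ub) x≢b
        (within⇒avoiding nu (connected⇒within vx vx′ (xu ◅ ub ◅ edge-sym x′b ◅ ε))
          ◅◅ ((x′b , x′≢u , b≢u) ◅ ε)))
      where
      x≢b : x ≢ b
      x≢b refl = ≡true⇒≢false vx nb
      x′≢u : x′ ≢ u
      x′≢u refl = ≡true⇒≢false vx′ nu
      b≢u : b ≢ u
      b≢u b≡u = edge⇒≢ ub (sym b≡u)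

    reachedForest⇒ : reachedForest k a b ≡ true → Within (reached k) a b
    reachedForest⇒ {a} {b} ab with reached k a | reached k b | F a b
    ... | true | true | true = refl , refl , refl

    reachedForest-subforest : IsSubforest G (reached k) (reachedForest k)
    reachedForest-subforest = record
      { e-sym   = λ a b → trans (cong (_∧ (reached k a ∧ reached k b)) (e-sym a b))
                                (cong (F b a ∧_) (∧-comm (reached k a) (reached k b)))
      ; e-inG   = λ a b ab → e-inG a b (proj₁ (reachedForest⇒ ab))
      ; e-inS   = λ a b ab → proj₁ (proj₂ (reachedForest⇒ ab))
      ; acyclic = λ (x , ys , len , unique , linked) →
          acyclic (x , ys , len , unique , Linked.map (λ ab → proj₁ (reachedForest⇒ ab)) linked)
      }

    frontier-leaf : frontier k u ≡ true → IsLeaf (reachedForest k) u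
    frontier-leaf {u} fu with frontier⇒ k fu
    ... | nu , x , vx , xu = countF-singleton (reachedForest k u) x ux only-x
      where
      reached-u : reached k u ≡ true
      reached-u = trans (cong (visited k u ∨_) fu) (∨-zeroʳ (visited k u))
      ux : reachedForest k u x ≡ true
      ux rewrite edge-sym xu | reached-u | vx = refl
      only-x : ∀ y → reachedForest k u y ≡ true → y ≡ x
      only-x y uy with reachedForest⇒ uy
      ... | uy′ , _ , ry with ∨-≡-true (visited k y) _ ry
      ...   | inj₁ vy = visited-neighbour-unique nu vy vx (edge-sym uy′) xu
      ...   | inj₂ fy = ⊥-elim (frontier-independent fu fy uy′)

    chosen∈frontier : anyF (frontier k) ≡ true →
                      frontier k (γ (reached k) (reachedForest k) (frontier k)) ≡ true
    chosen∈frontier some = IsChoiceFunction.choice choice (reached k) (reachedForest k) (frontier k)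
      reachedForest-subforest (inj₁ (anyF⇒∃ (frontier k) some , λ u → frontier-leaf))

  extend : ∀ k → Maybe (Fin n) → List (Fin n)
  extend k = maybe (λ v → V k ++ [ v ]) (V k)

  data Step (k : ℕ) : Set where
    finished  : (∀ u → visited k u ≡ true) → Step k
    new-root  : ∀ v → Appends k v → Closed k → IsRoot F v → Step k
    new-child : ∀ v x → Appends k v → visited k x ≡ true → F x v ≡ true → Step k

  closed-unvisited : ∀ k → Closed k → Connected F a b → visited k a ≡ false → visited k b ≡ false
  closed-unvisited k cl ε na = na
  closed-unvisited k cl (_◅_ {j = b} ab b~c) na with visited k b in vb
  ... | true  = ⊥-elim (≡true⇒≢false (cl _ _ vb (edge-sym ab)) na)
  ... | false = closed-unvisited k cl b~c vb

  no-frontier⇒closed : ∀ k → anyF (frontier k) ≡ false → Closed k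
  no-frontier⇒closed k none a b va ab with visited k b in vb
  ... | true  = refl
  ... | false = ⊥-elim (≡true⇒≢false fb (anyF-false (frontier k) none b))
    where
    fb : frontier k b ≡ true
    fb rewrite vb = anyF-intro (λ x → visited k x ∧ F x b) a (trans (cong (_∧ F a b) va) ab)

  step : ∀ k → Invariant k → Step k
  step k inv with anyF (frontier k) in some
  ... | true with frontier⇒ k (chosen∈frontier inv some)
  ...   | nv , x , vx , xv = new-child _ x (appends nv (cong (extend k) (if-cong some))) vx xv
  step k inv | false with firstF (λ u → not (visited k u)) in first
  ... | nothing = finished λ u → not-injective (firstF-nothing _ first u)
  ... | just v with firstF-just _ v first
  ...   | nv , least = new-root v (appends (not-injective nv) (cong (extend k) (trans (if-cong some) first))) cl
                         λ u v~u → least u (cong not (closed-unvisited k cl v~u (not-injective nv)))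
    where cl = no-frontier⇒closed k some

  module _ {k} (inv : Invariant k) where
    open Invariant inv

    private
      rooted-suc : visited k u ≡ true → RootedIn (suc k) u
      rooted-suc vu with rooted vu
      ... | r , root , vr , u~r = r , root , visited-suc {k = k} vr , within-mono (λ _ → visited-suc {k = k}) u~r

    invariant-finished : (∀ u → visited k u ≡ true) → Invariant (suc k)
    invariant-finished all = record
      { rooted          = λ {u} _ → rooted-suc (all u)
      ; exits-connected = λ {_} {b} _ _ nb → ⊥-elim (≡true⇒≢false (visited-suc {k = k} (all b)) nb)
      ; progress        = inj₁ λ u → visited-suc {k = k} (all u)
      }

    progress-append : Appends k v → (∀ u → visited (suc k) u ≡ true) ⊎ suc k ≤ countF (visited (suc k))
    progress-append {v} app@(appends nv _) with progress
    ... | inj₁ all = ⊥-elim (≡true⇒≢false (all v) nv)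
    ... | inj₂ k≤ = inj₂ (subst (suc k ≤_) (sym (Appended.count-append {k} app)) (s≤s k≤))

    invariant-new-root : Appends k v → Closed k → IsRoot F v → Invariant (suc k)
    invariant-new-root {v} app cl root = record
      { rooted          = rooted′
      ; exits-connected = λ va ab nb vc cd nd →
          subst₂ (Connected F) (exit-from-v va ab nb) (exit-from-v vc cd nd) ε
      ; progress        = progress-append app
      }
      where
      open Appended {k} app
      rooted′ : visited (suc k) u ≡ true → RootedIn (suc k) u
      rooted′ vu with visited-append⇒ vu
      ... | inj₁ old  = rooted-suc old
      ... | inj₂ refl = v , root , visited-appended , ε
      exit-from-v : visited (suc k) a ≡ true → F a b ≡ true → visited (suc k) b ≡ false → v ≡ a
      exit-from-v va ab nb with visited-append⇒ va
      ... | inj₁ old  = ⊥-elim (≡true⇒≢false (visited-suc {k = k} (cl _ _ old ab)) nb)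
      ... | inj₂ refl = refl

    invariant-new-child : Appends k v → visited k x ≡ true → F x v ≡ true → Invariant (suc k)
    invariant-new-child {v} {x} app@(appends nv _) vx xv = record
      { rooted          = rooted′
      ; exits-connected = λ va ab nb vc cd nd → exit-near-x va ab nb ◅◅ connected-sym (exit-near-x vc cd nd)
      ; progress        = progress-append app
      }
      where
      open Appended {k} app
      rooted′ : visited (suc k) u ≡ true → RootedIn (suc k) u
      rooted′ vu with visited-append⇒ vu
      ... | inj₁ old  = rooted-suc old
      ... | inj₂ refl with rooted-suc vx
      ...   | r , root , vr , x~r = r , root , vr , (edge-sym xv , visited-appended , visited-suc {k = k} vx) ◅ x~r
      exit-near-x : visited (suc k) a ≡ true → F a b ≡ true → visited (suc k) b ≡ false → Connected F a x
      exit-near-x va ab nb with visited-append⇒ va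
      ... | inj₁ old  = exits-connected old ab (unvisited-append⇒ nb) vx xv nv
      ... | inj₂ refl = edge-sym xv ◅ ε

  invariant : ∀ k → Invariant k
  invariant zero = record { rooted = λ () ; exits-connected = λ () ; progress = inj₂ z≤n }
  invariant (suc k) with step k (invariant k)
  ... | finished all          = invariant-finished (invariant k) all
  ... | new-root v app cl root = invariant-new-root (invariant k) app cl root
  ... | new-child v x app vx xv = invariant-new-child (invariant k) app vx xv

  π : Fin n → ℕ
  π = πinv γ F

  all-visited : ∀ u → visited n u ≡ true
  all-visited u with Invariant.progress (invariant n)
  ... | inj₁ all = all u
  ... | inj₂ n≤  = countF-≥⇒all (visited n) n≤ u

  π-injective : π u ≡ π w → u ≡ w
  π-injective = indexOf-injective (V n) (all-visited _) (all-visited _)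

  π-visited : ∀ k → k ≤ n → visited k u ≡ true → π u ≡ indexOf (V k) u
  π-visited {u} k k≤n vu with V-prefix k≤n
  ... | ys , eq = trans (cong (λ xs → indexOf xs u) eq) (indexOf-++ˡ (V k) ys u vu)

  π-unvisited : ∀ k → k ≤ n → visited k u ≡ false → length (V k) ≤ π u
  π-unvisited {u} k k≤n nu with V-prefix k≤n
  ... | ys , eq rewrite eq | indexOf-++ʳ (V k) ys u nu = m≤m+n (length (V k)) _

  module Position {k v} (k<n : k < n) (app : Appends k v) where
    open Appends app

    π-appended : π v ≡ length (V k)
    π-appended = begin
      π v                            ≡⟨ π-visited (suc k) k<n (Appended.visited-appended {k} app) ⟩
      indexOf (V (suc k)) v          ≡⟨ cong (λ xs → indexOf xs v) extends ⟩
      indexOf (V k ++ [ v ]) v       ≡⟨ indexOf-++ʳ (V k) [ v ] v unvisited ⟩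
      length (V k) + indexOf [ v ] v ≡⟨ cong (length (V k) +_) (indexOf-singleton v) ⟩
      length (V k) + 0               ≡⟨ +-identityʳ _ ⟩
      length (V k)                   ∎
      where open ≡-Reasoning

    visited⇒before : visited k u ≡ true → π u < π v
    visited⇒before {u} vu rewrite π-appended | π-visited k (<⇒≤ k<n) vu = indexOf-< (V k) u vu

    before⇒visited : π u < π v → visited k u ≡ true
    before⇒visited {u} u<v with visited k u in vu
    ... | true  = refl
    ... | false = ⊥-elim (<-irrefl refl
                    (<-≤-trans (subst (π u <_) π-appended u<v) (π-unvisited k (<⇒≤ k<n) vu)))

  data Placement (v : Fin n) : Set where
    placed-root  : ∀ {k} → k < n → Appends k v → Closed k → IsRoot F v → Placement v
    placed-child : ∀ {k} x → k < n → Appends k v → visited k x ≡ true → F x v ≡ true → Placement v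

  placement : ∀ v → Placement v
  placement v with first-visit (all-visited v)
  ... | k , k<n , nv , vv with step k (invariant k)
  ... | finished all = ⊥-elim (≡true⇒≢false (all v) nv)
  ... | new-root w app cl root with Appended.visited-append⇒ {k} app vv
  ...   | inj₁ vv′ = ⊥-elim (≡true⇒≢false vv′ nv)
  ...   | inj₂ refl = placed-root k<n app cl root
  placement v | k , k<n , nv , vv | new-child w x app vx xw with Appended.visited-append⇒ {k} app vv
  ...   | inj₁ vv′ = ⊥-elim (≡true⇒≢false vv′ nv)
  ...   | inj₂ refl = placed-child x k<n app vx xw

  module Child {k v x} (nv : visited k v ≡ false) (vx : visited k x ≡ true) (xv : F x v ≡ true) where
    open Invariant (invariant k)

    not-root : ¬ IsRoot F v
    not-root root with rooted vx
    ... | r , root′ , vr , x~r with root-unique root root′ (edge-sym xv ◅ within⇒connected x~r)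
    ... | refl = ≡true⇒≢false vr nv

    is-parent : IsParent F v x
    is-parent with rooted vx
    ... | r , root , _ , x~r = not-root , edge-sym xv , r , root , within⇒avoiding nv x~r

    -- Another parent p would reach the root of x avoiding v, closing a cycle through v.
    parent-unique : IsParent F v p → p ≡ x
    parent-unique {p} (_ , vp , r , root , p~r) with rooted vx
    ... | r′ , root′ , _ , x~r′
      with root-unique root root′
             (connected-sym (avoiding⇒connected p~r) ◅◅ edge-sym vp ◅ edge-sym xv ◅ within⇒connected x~r′)
    ... | refl with p ≟ x
    ...   | yes p≡x = p≡x
    ...   | no  p≢x = ⊥-elim (acyclic (avoidingWalk⇒cycle F v vp xv p≢x
                        (p~r ◅◅ avoiding-sym (within⇒avoiding nv x~r′))))

  root-or-parent : ∀ v → IsRoot F v ⊎ Σ (Fin n) (IsParent F v)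
  root-or-parent v with placement v
  ... | placed-root _ _ _ root            = inj₁ root
  ... | placed-child {k} x _ (appends nv _) vx xv = inj₂ (x , Child.is-parent {k} nv vx xv)

  parent-unique : IsParent F v p → IsParent F v q → p ≡ q
  parent-unique {v} vp vq with placement v
  ... | placed-root _ _ _ root          = ⊥-elim (proj₁ vp root)
  ... | placed-child {k} x _ (appends nv _) vx xv =
    trans (Child.parent-unique {k} nv vx xv vp) (sym (Child.parent-unique {k} nv vx xv vq))

  parent-before : IsParent F v p → π p < π v
  parent-before {v} vp with placement v
  ... | placed-root _ _ _ root              = ⊥-elim (proj₁ vp root)
  ... | placed-child {k} x k<n app@(appends nv _) vx xv rewrite Child.parent-unique {k} nv vx xv vp =
    Position.visited⇒before k<n app vx

  -- At the time a root is appended, V_k is closed under F.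
  root-neighbour-before : IsRoot F v → F a b ≡ true → π a < π v → π b < π v
  root-neighbour-before {v} root ab a<v with placement v
  ... | placed-root k<n app cl _ =
    Position.visited⇒before k<n app (cl _ _ (Position.before⇒visited k<n app a<v) ab)
  ... | placed-child {k} x _ (appends nv _) vx xv = ⊥-elim (Child.not-root {k} nv vx xv root)

  earlier-neighbour-parent : IsParent F v p → F v w ≡ true → π w < π v → w ≡ p
  earlier-neighbour-parent {v} vp vw w<v with placement v
  ... | placed-root _ _ _ root = ⊥-elim (proj₁ vp root)
  ... | placed-child {k} x k<n app@(appends nv _) vx xv =
    trans (visited-neighbour-unique (invariant k) nv (Position.before⇒visited k<n app w<v) vx (edge-sym vw) xv)
          (sym (Child.parent-unique {k} nv vx xv vp))

  -- When w is appended, the edges v–p and x–w (x the parent of w) both leave V_k, so they lie in one tree.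
  between-connected : ¬ IsRoot F w → IsParent F v p → π p < π w → π w < π v → Connected F v w
  between-connected {w} {v} {p} nw (_ , vp , _) p<w w<v with placement w
  ... | placed-root _ _ _ root = ⊥-elim (nw root)
  ... | placed-child {k} x k<n app@(appends nw′ _) vx xw =
    vp ◅ Invariant.exits-connected (invariant k) vp′ (edge-sym vp) nv vx xw nw′ ◅◅ xw ◅ ε
    where
    vp′ : visited k p ≡ true
    vp′ = Position.before⇒visited k<n app p<w
    nv : visited k v ≡ false
    nv with visited k v in vv
    ... | true  = ⊥-elim (<-irrefl refl (<-trans w<v (Position.visited⇒before k<n app vv)))
    ... | false = refl

module Redundancy {n : ℕ} (G : Graph n) (γ : ChoiceFn n) (choice : IsChoiceFunction G γ)
                  (F : ESet n) (forest : IsSpanningForest G F) where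

  open IsSubforest forest using (e-sym)
  open Forest G F forest
  open AlgorithmB G γ choice F forest

  private
    variable
      p q v w x y : Fin n

  ψ : ESet n → Fin n → Maybe ℕ
  ψ A v with root-or-parent v
  ... | inj₁ _       = nothing
  ... | inj₂ (p , _) = just (countBelow π A v (π p))

  ψ-isPsi : ∀ A → IsPsi γ A F (ψ A)
  ψ-isPsi A v with root-or-parent v
  ... | inj₁ root     = inj₁ (root , refl)
  ... | inj₂ (p , vp) = inj₂ (p , vp , refl)

  isPsi⇒≡ψ : ∀ {A f} → IsPsi γ A F f → ∀ v → f v ≡ ψ A v
  isPsi⇒≡ψ {A} {f} isPsi v with isPsi v | root-or-parent v
  ... | inj₁ (_ , fv)      | inj₁ _        = fv
  ... | inj₁ (root , _)    | inj₂ (_ , vp) = ⊥-elim (proj₁ vp root)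
  ... | inj₂ (_ , vp , _)  | inj₁ root     = ⊥-elim (proj₁ vp root)
  ... | inj₂ (p , vp , fv) | inj₂ (q , vq) rewrite parent-unique vp vq = fv

  -- Deleting the edge v w does not change the value of Ψ at v.
  Unaffected : Fin n → Fin n → Set
  Unaffected v w = ∀ p → IsParent F v p → π p ≤ π w

  module _ (A : ESet n) where

    ψ-deleteEdge-comm : ∀ v → ψ (deleteEdge A x y) v ≡ ψ (deleteEdge A y x) v
    ψ-deleteEdge-comm v with root-or-parent v
    ... | inj₁ _       = refl
    ... | inj₂ (p , _) = cong just (countBelow-deleteEdge-comm π A (π p))

    ψ-stable⇒unaffected : A x y ≡ true → ψ A x ≡ ψ (deleteEdge A x y) x → Unaffected x y
    ψ-stable⇒unaffected {x} {y} xy stable p xp with root-or-parent x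
    ... | inj₁ root = ⊥-elim (proj₁ xp root)
    ... | inj₂ (q , xq) rewrite parent-unique xp xq with π q ≤? π y
    ...   | yes q≤y = q≤y
    ...   | no  q≰y = ⊥-elim (1+n≢n (trans (sym (countBelow-deleteEdge-< π A xy (≰⇒> q≰y)))
                                            (just-injective stable)))

    unaffected⇒ψ-stable : Unaffected x y → Unaffected y x → ∀ v → ψ A v ≡ ψ (deleteEdge A x y) v
    unaffected⇒ψ-stable {x} {y} uxy uyx v with root-or-parent v
    ... | inj₁ _        = refl
    ... | inj₂ (p , vp) = cong just (sym (unchanged (v ≟ x) (v ≟ y)))
      where
      unchanged : Dec (v ≡ x) → Dec (v ≡ y) →
                  countBelow π (deleteEdge A x y) v (π p) ≡ countBelow π A v (π p)
      unchanged (yes refl) _          = countBelow-deleteEdge-≤ π A (uxy p vp)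
      unchanged (no _)     (yes refl) =
        trans (countBelow-deleteEdge-comm π A (π p)) (countBelow-deleteEdge-≤ π A (uyx p vp))
      unchanged (no v≢x)   (no v≢y)   = countBelow-deleteEdge-≢ π A (π p) v≢x v≢y

  redundant⇔unaffected : adj G x y ≡ true →
                         Redundant G γ F x y ⇔ (F x y ≡ false × Unaffected x y × Unaffected y x)
  redundant⇔unaffected {x} {y} xy = mk⇔ to from
    where
    A = adj G
    to : Redundant G γ F x y → F x y ≡ false × Unaffected x y × Unaffected y x
    to (nxy , same) =
      nxy , ψ-stable⇒unaffected A xy (stable x) ,
      ψ-stable⇒unaffected A yx (trans (stable y) (ψ-deleteEdge-comm A y))
      where
      yx = trans (Graph.sym G y x) xy
      stable : ∀ v → ψ A v ≡ ψ (deleteEdge A x y) v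
      stable = same (ψ A) (ψ (deleteEdge A x y)) (ψ-isPsi A) (ψ-isPsi (deleteEdge A x y))
    from : F x y ≡ false × Unaffected x y × Unaffected y x → Redundant G γ F x y
    from (nxy , uxy , uyx) = nxy , λ f g f-isPsi g-isPsi v →
      trans (isPsi⇒≡ψ f-isPsi v) (trans (unaffected⇒ψ-stable A uxy uyx v) (sym (isPsi⇒≡ψ g-isPsi v)))

  parent-before-non-neighbour : IsParent F v p → F v w ≡ false → Unaffected v w → π p < π w
  parent-before-non-neighbour {v} {p} {w} vp nvw uvw = ≤∧≢⇒< (uvw p vp) λ πp≡πw →
    ≡true⇒≢false (subst (λ u → F v u ≡ true) (π-injective πp≡πw) (proj₁ (proj₂ vp))) nvw

  cases⇒unaffected : Cases γ F v w → F v w ≡ false × Unaffected v w × Unaffected w v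
  cases⇒unaffected (inj₁ (rv , rw)) =
    ¬-not (λ vw → edge⇒≢ vw (root-unique rv rw (vw ◅ ε))) ,
    (λ _ vp → ⊥-elim (proj₁ vp rv)) , (λ _ wp → ⊥-elim (proj₁ wp rw))
  cases⇒unaffected (inj₂ (inj₁ (rv , _ , w<v))) =
    ¬-not (λ vw → <-irrefl refl (root-neighbour-before rv (edge-sym vw) w<v)) ,
    (λ _ vp → ⊥-elim (proj₁ vp rv)) , (λ _ wp → <⇒≤ (<-trans (parent-before wp) w<v))
  cases⇒unaffected (inj₂ (inj₂ (_ , _ , p , vp , p<w , w<v))) =
    ¬-not (λ vw → <-irrefl (cong π (sym (earlier-neighbour-parent vp vw w<v))) p<w) ,
    (λ q vq → subst (λ u → π u ≤ π _) (sym (parent-unique vq vp)) (<⇒≤ p<w)) ,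
    (λ _ wq → <⇒≤ (<-trans (parent-before wq) w<v))

  unaffected⇒case2 : IsRoot F v → IsParent F w p → F w v ≡ false → Unaffected w v → Case2 γ F v w
  unaffected⇒case2 rv wp nwv uwv =
    rv , proj₁ wp ,
    root-neighbour-before rv (edge-sym (proj₁ (proj₂ wp))) (parent-before-non-neighbour wp nwv uwv)

  unaffected⇒case3 : IsParent F v p → IsParent F w q → F v w ≡ false → Unaffected v w → π w < π v →
                     Case3 γ F v w
  unaffected⇒case3 {p = p} vp wq nvw uvw w<v =
    proj₁ vp , proj₁ wq , p , vp , parent-before-non-neighbour vp nvw uvw , w<v

  unaffected⇒cases : adj G x y ≡ true → F x y ≡ false → Unaffected x y → Unaffected y x →
                     Cases γ F x y ⊎ Cases γ F y x
  unaffected⇒cases {x} {y} xy nxy uxy uyx with root-or-parent x | root-or-parent y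
  ... | inj₁ rx       | inj₁ ry       = inj₁ (inj₁ (rx , ry))
  ... | inj₁ rx       | inj₂ (_ , yp) = inj₁ (inj₂ (inj₁ (unaffected⇒case2 rx yp nyx uyx)))
    where nyx = trans (e-sym y x) nxy
  ... | inj₂ (_ , xp) | inj₁ ry       = inj₂ (inj₂ (inj₁ (unaffected⇒case2 ry xp nxy uxy)))
  ... | inj₂ (_ , xp) | inj₂ (_ , yp) with <-cmp (π y) (π x)
  ...   | tri< y<x _ _ = inj₁ (inj₂ (inj₂ (unaffected⇒case3 xp yp nxy uxy y<x)))
  ...   | tri≈ _ πy≡πx _ = ⊥-elim (adj⇒≢ G xy (π-injective (sym πy≡πx)))
  ...   | tri> _ _ x<y = inj₂ (inj₂ (inj₂ (unaffected⇒case3 yp xp (trans (e-sym y x) nxy) uyx x<y)))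

  cases⇔unaffected : adj G x y ≡ true →
                     (Cases γ F x y ⊎ Cases γ F y x) ⇔ (F x y ≡ false × Unaffected x y × Unaffected y x)
  cases⇔unaffected {x} {y} xy = mk⇔ to (λ (nxy , uxy , uyx) → unaffected⇒cases xy nxy uxy uyx)
    where
    to : Cases γ F x y ⊎ Cases γ F y x → F x y ≡ false × Unaffected x y × Unaffected y x
    to (inj₁ c) = cases⇒unaffected c
    to (inj₂ c) with cases⇒unaffected c
    ... | nyx , uyx , uxy = trans (e-sym x y) nyx , uxy , uyx

proposition4p1 : ∀ {n : ℕ} (G : Graph n) (γ : ChoiceFn n) → IsChoiceFunction G γ →
                 (F : ESet n) → IsSpanningForest G F →
                 (x y : Fin n) → adj G x y ≡ true →
                 (Redundant G γ F x y ⇔ (Cases γ F x y ⊎ Cases γ F y x))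
                 × (∀ v w → (v ≡ x × w ≡ y) ⊎ (v ≡ y × w ≡ x) →
                      Case3 γ F v w → Connected F v w)
proposition4p1 G γ choice F forest x y xy =
  ⇔-sym (cases⇔unaffected xy) ⇔-∘ redundant⇔unaffected xy ,
  λ { _ _ _ (_ , nw , _ , vp , p<w , w<v) → between-connected nw vp p<w w<v }
  where
  open AlgorithmB G γ choice F forest using (between-connected)
  open Redundancy G γ choice F forest
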